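{- Let $n\ge1$ and let $\sigma\in B_n$ have A-code $a=(a_1,\ldots,a_n)$. Then $$inv_B(\sigma)=\sum_{i=1}^n\bigl(i-a_i-\chi(a_i<0)\bigr)\qquad\text{and}\qquad nmin_B(\sigma)=n-|\mathrm{Max}\,a|.$$
   Context: $B_n$ is the group of bijections $\sigma$ of $\{\pm1,\ldots,\pm n\}$ with $\sigma(-i)=-\sigma(i)$, written $\sigma_1\cdots\sigma_n$ with $\sigma_i=\sigma(i)$. $\mathrm{Leh}\,\sigma=(a_1,\ldots,a_n)$ with $a_i=\mathrm{sign}(\sigma_i)\cdot|\{j\le i:|\sigma_j|\le|\sigma_i|\}|$; the A-code of $\sigma$ is $\mathrm{Leh}(\sigma^{ -1})$. $\mathrm{Max}\,a=\{i:a_i=i\}$. $\chi(P)$ is $1$ if $P$ holds and $0$ otherwise. $inv_B(\sigma)=|\{(i,j):1\le i<j\le n,\ \sigma_i>\sigma_j\}|+|\{(i,j):1\le i\le j\le n,\ -\sigma_i>\sigma_j\}|$. $nmin_B(\sigma)=|\{i:\sigma_i>|\sigma_j|\text{ for some }j>i\}|+N(\sigma)$, where $N(\sigma)$ is the number of $i$ with $\sigma_i<0$. -}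

module Defs where

open import Data.Nat as ℕ using (ℕ; zero; suc)
open import Data.Integer as ℤ using (ℤ; +_; -[1+_]; ∣_∣; -_)
import Data.Integer.Properties as ℤP
import Data.Nat.Properties as ℕP
open import Data.Fin using (Fin; toℕ; fromℕ<)
open import Data.List using (List; filter; length; map; foldr; allFin; cartesianProduct)
open import Data.Bool.ListAction using (any)
open import Data.Bool using (Bool; if_then_else_; T?)
open import Data.Product using (_×_; _,_; proj₁; proj₂)
open import Relation.Binary.PropositionalEquality using (_≡_)
open import Relation.Nullary using (does; ¬_)
open import Relation.Nullary.Decidable using (_×-dec_; _⊎-dec_)

-- An element of B_n is determined by its window σ₁⋯σₙ (σᵢ = σ(i)), since σ(-i) = -σ(i).
-- The window is a list of nonzero integers in [-n,n] whose absolute values are distinct.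
record SignedPerm (n : ℕ) : Set where
  field
    σ       : Fin n → ℤ
    bounded : ∀ i → 1 ℕ.≤ ∣ σ i ∣ × ∣ σ i ∣ ℕ.≤ n
    absInj  : ∀ i j → ∣ σ i ∣ ≡ ∣ σ j ∣ → i ≡ j
open SignedPerm public

-- The (odd) extension of a window to a map on ℤ: value at ±k (1 ≤ k ≤ n) is ±σ_k;
-- outside {±1,…,±n} it returns 0 (irrelevant).
ext : ∀ {n} → (Fin n → ℤ) → ℤ → ℤ
ext {n} w (+ zero) = + 0
ext {n} w (+ (suc k)) with k ℕ.<? n
... | Relation.Nullary.yes p = w (fromℕ< p)
... | Relation.Nullary.no _  = + 0
ext {n} w -[1+ k ] with k ℕ.<? n
... | Relation.Nullary.yes p = - w (fromℕ< p)
... | Relation.Nullary.no _  = + 0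

-- τ is the inverse of σ in B_n: τ(σ(i)) = i for all i ∈ {1,…,n}
-- (positions are 0-based Fin indices, so position i stands for i+1).
IsInverse : ∀ {n} → SignedPerm n → SignedPerm n → Set
IsInverse s t = ∀ i → ext (σ t) (σ s i) ≡ + suc (toℕ i)

count : ∀ {n} → (Fin n → Bool) → ℕ
count {n} p = length (filter (λ i → T? (p i)) (allFin n))

count₂ : ∀ {n} → (Fin n → Fin n → Bool) → ℕ
count₂ {n} p = length (filter (λ ij → T? (p (proj₁ ij) (proj₂ ij)))
                        (cartesianProduct (allFin n) (allFin n)))

sumℤ : ∀ {n} → (Fin n → ℤ) → ℤ
sumℤ {n} f = foldr ℤ._+_ (+ 0) (map f (allFin n))

Leh : ∀ {n} → (Fin n → ℤ) → Fin n → ℤ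
Leh w i = if does (w i ℤ.<? + 0) then - (+ c) else + c
  where c = count (λ j → does ((toℕ j ℕ.≤? toℕ i) ×-dec (∣ w j ∣ ℕ.≤? ∣ w i ∣)))

maxCount : ∀ {n} → (Fin n → ℤ) → ℕ
maxCount a = count (λ i → does (a i ℤ.≟ + suc (toℕ i)))

invB : ∀ {n} → SignedPerm n → ℕ
invB s = count₂ (λ i j → does ((toℕ i ℕ.<? toℕ j) ×-dec (σ s j ℤ.<? σ s i)))
       ℕ.+ count₂ (λ i j → does ((toℕ i ℕ.≤? toℕ j) ×-dec (σ s j ℤ.<? - σ s i)))

negCount : ∀ {n} → SignedPerm n → ℕ
negCount s = count (λ i → does (σ s i ℤ.<? + 0))

nminB : ∀ {n} → SignedPerm n → ℕ
nminB {n} s = count (λ i → any (λ j → does ((toℕ i ℕ.<? toℕ j) ×-dec (+ ∣ σ s j ∣ ℤ.<? σ s i))) (allFin n))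
            ℕ.+ negCount s

χneg : ℤ → ℤ
χneg x = if does (x ℤ.<? + 0) then + 1 else + 0

-- Let v(i) = |σ_i| − 1. Since τ = σ⁻¹ has τ_{v(i)} = ±(i+1) with the sign of σ_i, the code
-- entry at v(i) is a = ±c_i with c_i = #{j ≤ i : |σ_j| ≤ |σ_i|}. Exactly |σ_i| entries have
-- absolute value at most |σ_i|, so the summand at v(i) equals #{j > i : |σ_j| < |σ_i|} if σ_i > 0
-- and |σ_i| + #{j < i : |σ_j| < |σ_i|} if σ_i < 0. Summing over i, these counts agree with inv_B
-- once every unordered pair {i, j} is taken together: the contributions of a pair to either side
-- depend only on the order of i and j, the signs of σ_i and σ_j and the order of |σ_i| and |σ_j|,
-- and they agree in all sixteen cases. For nmin_B, every i satisfies exactly one of: σ_i < 0;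
-- σ_i > 0 and a smaller absolute value occurs to its right; σ_i > 0 and c_i = |σ_i|, that is,
-- v(i) ∈ Max a.

module Submission where

open import Defs
open import Data.Nat as ℕ using (ℕ; zero; suc; _+_; _*_; _≤_; _<_; _∸_; s≤s)
open import Data.Integer as ℤ using (ℤ; +_; -[1+_]; ∣_∣; -_)
import Data.Integer.Properties as ℤP
import Data.Nat.Properties as ℕP
open import Data.Fin as F using (Fin; toℕ; fromℕ<)
import Data.Fin.Properties as FP
open import Data.Fin.Permutation as Perm using (Permutation)
open import Data.List using (_++_; filter; length; map; foldr; allFin; tabulate; cartesianProduct)
import Data.List.Properties as LP
import Data.Bool.Properties as BP
open import Data.Bool using (Bool; true; false; if_then_else_; T?; _∧_; not)
open import Data.Bool.ListAction using (any)
open import Data.Product using (_×_; _,_; proj₁; proj₂)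
open import Data.Empty using (⊥-elim)
open import Function using (_∘_; id; mk⇔)
open import Relation.Binary.PropositionalEquality
open import Relation.Nullary using (does; Dec; yes; no; _×-dec_; ¬?)
open import Relation.Nullary.Decidable using (dec-true; dec-false; does-⇔)
import Algebra.Properties.CommutativeMonoid.Sum as CommutativeMonoidSum

module ℕΣ = CommutativeMonoidSum ℕP.+-0-commutativeMonoid
module ℤΣ = CommutativeMonoidSum ℤP.+-0-commutativeMonoid
open ℕΣ using (sum; sum-syntax)
open ≡-Reasoning

𝟙 : Bool → ℕ
𝟙 true  = 1
𝟙 false = 0

does-≤?-suc : ∀ a b → does (suc a ℕ.≤? suc b) ≡ does (a ℕ.≤? b)
does-≤?-suc a b = does-⇔ (mk⇔ ℕP.≤-pred s≤s) (suc a ℕ.≤? suc b) (a ℕ.≤? b)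

does-≤?-refl : ∀ a → does (a ℕ.≤? a) ≡ true
does-≤?-refl a = dec-true (a ℕ.≤? a) ℕP.≤-refl

does-<?-irrefl : ∀ a → does (a ℕ.<? a) ≡ false
does-<?-irrefl a = dec-false (a ℕ.<? a) (ℕP.<-irrefl refl)

≤?≡<? : ∀ {a b} → a ≢ b → does (a ℕ.≤? b) ≡ does (a ℕ.<? b)
≤?≡<? {a} {b} a≢b = does-⇔ (mk⇔ (λ a≤b → ℕP.≤∧≢⇒< a≤b a≢b) ℕP.<⇒≤) (a ℕ.≤? b) (a ℕ.<? b)

≤?≡not-<? : ∀ a b → does (b ℕ.≤? a) ≡ not (does (a ℕ.<? b))
≤?≡not-<? a b = does-⇔ (mk⇔ ℕP.≤⇒≯ ℕP.≮⇒≥) (b ℕ.≤? a) (¬? (a ℕ.<? b))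

<?-flip : ∀ {a b} → a ≢ b → does (b ℕ.<? a) ≡ not (does (a ℕ.<? b))
<?-flip {a} {b} a≢b = does-⇔ (mk⇔ ℕP.<⇒≯ (λ a≮b → ℕP.≤∧≢⇒< (ℕP.≮⇒≥ a≮b) (a≢b ∘ sym)))
                              (b ℕ.<? a) (¬? (a ℕ.<? b))

𝟙-∧-split : ∀ a b c → a ≡ not b → 𝟙 (a ∧ c) + 𝟙 (b ∧ c) ≡ 𝟙 c
𝟙-∧-split .false true  c refl = refl
𝟙-∧-split .true  false c refl = ℕP.+-identityʳ (𝟙 c)

count-tabulate : ∀ {a} {A : Set a} n (g : Fin n → A) (p : A → Bool) →
  length (filter (λ x → T? (p x)) (tabulate g)) ≡ ∑[ i < n ] 𝟙 (p (g i))
count-tabulate zero    g p = refl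
count-tabulate (suc n) g p with p (g F.zero)
... | true  = cong suc (count-tabulate n (g ∘ F.suc) p)
... | false = count-tabulate n (g ∘ F.suc) p

count≡∑ : ∀ {n} (p : Fin n → Bool) → count p ≡ ∑[ i < n ] 𝟙 (p i)
count≡∑ {n} p = count-tabulate n id p

count₂≡∑∑ : ∀ {n} (p : Fin n → Fin n → Bool) → count₂ p ≡ ∑[ i < n ] ∑[ j < n ] 𝟙 (p i j)
count₂≡∑∑ {n} p = pairs n id
  where
  P? = λ (ij : Fin n × Fin n) → T? (p (proj₁ ij) (proj₂ ij))

  pairs : ∀ k (g : Fin k → Fin n) →
    length (filter P? (cartesianProduct (tabulate g) (allFin n))) ≡ ∑[ i < k ] ∑[ j < n ] 𝟙 (p (g i) j)
  pairs zero    g = refl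
  pairs (suc k) g = begin
    length (filter P? (row ++ rest))                    ≡⟨ cong length (LP.filter-++ P? row rest) ⟩
    length (filter P? row ++ filter P? rest)            ≡⟨ LP.length-++ (filter P? row) ⟩
    length (filter P? row) + length (filter P? rest)    ≡⟨ cong₂ _+_ row-count (pairs k (g ∘ F.suc)) ⟩
    ∑[ i < suc k ] ∑[ j < n ] 𝟙 (p (g i) j)             ∎
    where
    row  = map (g F.zero ,_) (allFin n)
    rest = cartesianProduct (tabulate (g ∘ F.suc)) (allFin n)
    row-count : length (filter P? row) ≡ ∑[ j < n ] 𝟙 (p (g F.zero) j)
    row-count = trans (cong (length ∘ filter P?) (LP.map-tabulate id (g F.zero ,_)))
                      (count-tabulate n (g F.zero ,_) (λ ij → p (proj₁ ij) (proj₂ ij)))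

sumℤ≡∑ : ∀ {n} (f : Fin n → ℤ) → sumℤ f ≡ ℤΣ.sum f
sumℤ≡∑ {n} f = go n id
  where
  go : ∀ k (g : Fin k → Fin n) → foldr ℤ._+_ (+ 0) (map f (tabulate g)) ≡ ℤΣ.sum (f ∘ g)
  go zero    g = refl
  go (suc k) g = cong (λ z → f (g F.zero) ℤ.+ z) (go k (g ∘ F.suc))

+-∑ : ∀ {n} (f : Fin n → ℕ) → + (∑[ i < n ] f i) ≡ ℤΣ.sum (+_ ∘ f)
+-∑ {zero}  f = refl
+-∑ {suc n} f = trans (ℤP.pos-+ (f F.zero) _) (cong (λ z → + f F.zero ℤ.+ z) (+-∑ (f ∘ F.suc)))

any-tabulate : ∀ {a} {A : Set a} n (g : Fin n → A) (q : A → Bool) →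
  any q (tabulate g) ≡ does (0 ℕ.<? ∑[ i < n ] 𝟙 (q (g i)))
any-tabulate zero    g q = refl
any-tabulate (suc n) g q with q (g F.zero)
... | true  = refl
... | false = any-tabulate n (g ∘ F.suc) q

∑-zero : ∀ {n} (f : Fin n → ℕ) → (∀ i → f i ≡ 0) → ∑[ i < n ] f i ≡ 0
∑-zero {n} f f≡0 = trans (ℕΣ.sum-cong-≗ f≡0) (ℕΣ.sum-replicate-zero n)

∑-one : ∀ {n} (f : Fin n → ℕ) → (∀ i → f i ≡ 1) → ∑[ i < n ] f i ≡ n
∑-one {zero}  f f≡1 = refl
∑-one {suc n} f f≡1 = cong₂ _+_ (f≡1 F.zero) (∑-one (f ∘ F.suc) (f≡1 ∘ F.suc))

∑-if : ∀ {n} b (f g : Fin n → ℕ) →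
  ∑[ i < n ] (if b then f i else g i) ≡ (if b then ∑[ i < n ] f i else ∑[ i < n ] g i)
∑-if true  f g = refl
∑-if false f g = refl

∑-indicator-≡ : ∀ {n} (i : Fin n) → ∑[ j < n ] 𝟙 (does (j F.≟ i)) ≡ 1
∑-indicator-≡ {suc n} F.zero    = cong suc (∑-zero {n} _ (λ _ → refl))
∑-indicator-≡ {suc n} (F.suc i) = ∑-indicator-≡ i

∑-indicator-< : ∀ {n} k → k ≤ n → ∑[ v < n ] 𝟙 (does (toℕ v ℕ.<? k)) ≡ k
∑-indicator-< {n}     zero    _         = ∑-zero {n} _ (λ _ → refl)
∑-indicator-< {suc n} (suc k) (s≤s k≤n) = cong suc (trans
  (ℕΣ.sum-cong-≗ {n} (λ v → cong 𝟙 (does-≤?-suc (suc (toℕ v)) k))) (∑-indicator-< k k≤n))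

∑∑-symmetrize : ∀ {n} (f g : Fin n → Fin n → ℕ) → (∀ i j → f i j + f j i ≡ g i j + g j i) →
  ∑[ i < n ] ∑[ j < n ] f i j ≡ ∑[ i < n ] ∑[ j < n ] g i j
∑∑-symmetrize {n} f g fg = ℕP.*-cancelˡ-≡ _ _ 2 (begin
  2 * ∑∑ f                                       ≡⟨ ∑∑-double f ⟨
  ∑[ i < n ] ∑[ j < n ] (f i j + f j i)          ≡⟨ ℕΣ.sum-cong-≗ (λ i → ℕΣ.sum-cong-≗ (fg i)) ⟩
  ∑[ i < n ] ∑[ j < n ] (g i j + g j i)          ≡⟨ ∑∑-double g ⟩
  2 * ∑∑ g                                       ∎)
  where
  ∑∑ : (Fin n → Fin n → ℕ) → ℕ
  ∑∑ h = ∑[ i < n ] ∑[ j < n ] h i j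

  ∑∑-double : ∀ h → ∑[ i < n ] ∑[ j < n ] (h i j + h j i) ≡ 2 * ∑∑ h
  ∑∑-double h = begin
    ∑[ i < n ] ∑[ j < n ] (h i j + h j i)
      ≡⟨ ℕΣ.sum-cong-≗ (λ i → ℕΣ.∑-distrib-+ (h i) (λ j → h j i)) ⟩
    ∑[ i < n ] (∑[ j < n ] h i j + ∑[ j < n ] h j i)
      ≡⟨ ℕΣ.∑-distrib-+ (λ i → ∑[ j < n ] h i j) (λ i → ∑[ j < n ] h j i) ⟩
    ∑∑ h + ∑[ i < n ] ∑[ j < n ] h j i
      ≡⟨ cong (_+_ (∑∑ h)) (sym (trans (ℕP.*-identityˡ _) (ℕΣ.∑-comm h))) ⟩
    2 * ∑∑ h ∎

isNeg : ℤ → Bool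
isNeg x = does (x ℤ.<? + 0)

signed : Bool → ℕ → ℤ
signed true  c = - (+ c)
signed false c = + c

if-signed : ∀ b c → (if b then - (+ c) else + c) ≡ signed b c
if-signed true  c = refl
if-signed false c = refl

isNeg-signed : ∀ b k → isNeg (signed b (suc k)) ≡ b
isNeg-signed true  k = refl
isNeg-signed false k = refl

∣signed∣ : ∀ b c → ∣ signed b c ∣ ≡ c
∣signed∣ true  c = ℤP.∣-i∣≡∣i∣ (+ c)
∣signed∣ false c = refl

ltSigned : Bool → Bool → Bool → Bool
ltSigned false false b = b
ltSigned false true  _ = true
ltSigned true  false _ = false
ltSigned true  true  b = not b

<?-by-sign : ∀ x y → 1 ≤ ∣ x ∣ → 1 ≤ ∣ y ∣ → ∣ x ∣ ≢ ∣ y ∣ →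
  does (y ℤ.<? x) ≡ ltSigned (isNeg x) (isNeg y) (does (∣ y ∣ ℕ.<? ∣ x ∣))
<?-by-sign (+ zero)  _         ()     _      _
<?-by-sign _         (+ zero)  _      ()     _
<?-by-sign (+ suc a) (+ suc b) _      _      _       = refl
<?-by-sign (+ suc a) -[1+ b ]  _      _      _       = refl
<?-by-sign -[1+ a ]  (+ suc b) _      _      _       = refl
<?-by-sign -[1+ a ]  -[1+ b ]  _      _      ∣x∣≢∣y∣ = <?-flip (∣x∣≢∣y∣ ∘ cong suc ∘ sym)

<?-negate-by-sign : ∀ x y → 1 ≤ ∣ x ∣ → 1 ≤ ∣ y ∣ → ∣ x ∣ ≢ ∣ y ∣ →
  does (y ℤ.<? - x) ≡ ltSigned (not (isNeg x)) (isNeg y) (does (∣ y ∣ ℕ.<? ∣ x ∣))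
<?-negate-by-sign (+ zero)  _         ()     _      _
<?-negate-by-sign _         (+ zero)  _      ()     _
<?-negate-by-sign (+ suc a) (+ suc b) _      _      _       = refl
<?-negate-by-sign (+ suc a) -[1+ b ]  _      _      ∣x∣≢∣y∣ = <?-flip (∣x∣≢∣y∣ ∘ cong suc ∘ sym)
<?-negate-by-sign -[1+ a ]  (+ suc b) _      _      _       = refl
<?-negate-by-sign -[1+ a ]  -[1+ b ]  _      _      _       = refl

<?-negate-self : ∀ x → 1 ≤ ∣ x ∣ → does (x ℤ.<? - x) ≡ isNeg x
<?-negate-self (+ suc a) _ = refl
<?-negate-self -[1+ a ]  _ = refl

+<?-nonneg : ∀ k x → isNeg x ≡ false → does (+ k ℤ.<? x) ≡ does (k ℕ.<? ∣ x ∣)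
+<?-nonneg k (+ m) _ = refl

+<?-neg : ∀ k x → isNeg x ≡ true → does (+ k ℤ.<? x) ≡ false
+<?-neg k -[1+ m ] _ = refl

index : ∀ {n} (x : ℤ) → 1 ≤ ∣ x ∣ × ∣ x ∣ ≤ n → Fin n
index x bnd = fromℕ< (pred< bnd)
  where
  pred< : ∀ {m n} → 1 ≤ m × m ≤ n → ℕ.pred m < n
  pred< {suc m} (_ , m<n) = m<n

suc-index : ∀ {n} (x : ℤ) (bnd : 1 ≤ ∣ x ∣ × ∣ x ∣ ≤ n) → suc (toℕ (index x bnd)) ≡ ∣ x ∣
suc-index x (1≤∣x∣ , _) = trans (cong suc (FP.toℕ-fromℕ< _)) (ℕP.suc-pred ∣ x ∣ {{ℕ.>-nonZero 1≤∣x∣}})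

ext-inverse : ∀ {n} (τ : Fin n → ℤ) (x : ℤ) (bnd : 1 ≤ ∣ x ∣ × ∣ x ∣ ≤ n) {c} →
  ext τ x ≡ + suc c → τ (index x bnd) ≡ signed (isNeg x) (suc c)
ext-inverse     τ (+ zero)  (() , _)
ext-inverse {n} τ (+ suc a) (_ , a<n) ext≡ with a ℕ.<? n
... | yes _   = ext≡
... | no  a≮n = ⊥-elim (a≮n a<n)
ext-inverse {n} τ -[1+ a ]  (_ , a<n) ext≡ with a ℕ.<? n
... | yes _   = trans (sym (ℤP.neg-involutive _)) (cong -_ ext≡)
... | no  a≮n = ⊥-elim (a≮n a<n)

absIndex : ∀ {n} → SignedPerm n → Fin n → Fin n
absIndex s i = index (σ s i) (bounded s i)

absIndex-injective : ∀ {n} (s : SignedPerm n) {i j} → absIndex s i ≡ absIndex s j → i ≡ j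
absIndex-injective s {i} {j} e = absInj s i j (begin
  ∣ σ s i ∣                    ≡⟨ suc-index (σ s i) (bounded s i) ⟨
  suc (toℕ (absIndex s i))     ≡⟨ cong (suc ∘ toℕ) e ⟩
  suc (toℕ (absIndex s j))     ≡⟨ suc-index (σ s j) (bounded s j) ⟩
  ∣ σ s j ∣                    ∎)

positive-or-equal : ∀ c z m → c + z ≡ m → 𝟙 (does (0 ℕ.<? z)) + 𝟙 (does (+ c ℤ.≟ + m)) ≡ 1
positive-or-equal c zero    m c+0≡m = cong 𝟙 (dec-true (+ c ℤ.≟ + m) (cong +_ (trans (sym (ℕP.+-identityʳ c)) c+0≡m)))
positive-or-equal c (suc z) m c+z≡m =
  cong (suc ∘ 𝟙) (dec-false (+ c ℤ.≟ + m) (λ c≡m → ℕP.m+1+n≢m c (trans c+z≡m (sym (ℤP.+-injective c≡m)))))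

summand-neg : ∀ m e → (+ m ℤ.- signed true (suc e)) ℤ.- χneg (signed true (suc e)) ≡ + (m + e)
summand-neg m e rewrite ℕP.+-suc m e = refl

summand-nonneg : ∀ c l → (+ (c + l) ℤ.- signed false c) ℤ.- χneg (signed false c) ≡ + l
summand-nonneg c l = begin
  (+ (c + l) ℤ.- + c) ℤ.+ + 0    ≡⟨ ℤP.+-identityʳ _ ⟩
  + (c + l) ℤ.- + c              ≡⟨ ℤP.[+m]-[+n]≡m⊖n (c + l) c ⟩
  (c + l) ℤ.⊖ c                  ≡⟨ ℤP.⊖-≥ (ℕP.m≤m+n c l) ⟩
  + (c + l ∸ c)                  ≡⟨ cong +_ (ℕP.m+n∸m≡n c l) ⟩
  + l                            ∎

pair-truth-table : ∀ lt sx sy b →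
  (𝟙 (lt ∧ ltSigned sx sy b) + 𝟙 (lt ∧ ltSigned (not sx) sy b))
    + (𝟙 (not lt ∧ ltSigned sy sx (not b)) + 𝟙 (not lt ∧ ltSigned (not sy) sx (not b)))
  ≡ (if sx then 𝟙 b + 𝟙 (not lt ∧ b) else 𝟙 (lt ∧ b))
    + (if sy then 𝟙 (not b) + 𝟙 (lt ∧ not b) else 𝟙 (not lt ∧ not b))
pair-truth-table true  true  true  true  = refl
pair-truth-table true  true  true  false = refl
pair-truth-table true  true  false true  = refl
pair-truth-table true  true  false false = refl
pair-truth-table true  false true  true  = refl
pair-truth-table true  false true  false = refl
pair-truth-table true  false false true  = refl
pair-truth-table true  false false false = refl
pair-truth-table false true  true  true  = refl
pair-truth-table false true  true  false = refl
pair-truth-table false true  false true  = refl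
pair-truth-table false true  false false = refl
pair-truth-table false false true  true  = refl
pair-truth-table false false true  false = refl
pair-truth-table false false false true  = refl
pair-truth-table false false false false = refl

pair-table : ∀ {lt sx sy b : Bool} {P₁ P₂ P₃ P₄ M₁ M₂ A₁ A₂ A₃ A₄ : Bool} →
  P₁ ≡ lt → P₂ ≡ lt → P₃ ≡ not lt → P₄ ≡ not lt → M₁ ≡ b → M₂ ≡ not b →
  A₁ ≡ ltSigned sx sy b → A₂ ≡ ltSigned (not sx) sy b →
  A₃ ≡ ltSigned sy sx (not b) → A₄ ≡ ltSigned (not sy) sx (not b) →
  (𝟙 (P₁ ∧ A₁) + 𝟙 (P₂ ∧ A₂)) + (𝟙 (P₃ ∧ A₃) + 𝟙 (P₄ ∧ A₄))
  ≡ (if sx then 𝟙 M₁ + 𝟙 (P₃ ∧ M₁) else 𝟙 (P₁ ∧ M₁))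
    + (if sy then 𝟙 M₂ + 𝟙 (P₁ ∧ M₂) else 𝟙 (P₃ ∧ M₂))
pair-table {lt} {sx} {sy} {b} refl refl refl refl refl refl refl refl refl refl = pair-truth-table lt sx sy b

module InversePair {n} (s t : SignedPerm n) (t-inverse : IsInverse s t) where

  w τ : Fin n → ℤ
  w = σ s
  τ = σ t

  ∣w∣ : Fin n → ℕ
  ∣w∣ i = ∣ w i ∣

  neg : Fin n → Bool
  neg i = isNeg (w i)

  nonzero : ∀ i → 1 ≤ ∣w∣ i
  nonzero i = proj₁ (bounded s i)

  ∣w∣-≢ : ∀ {i j} → i ≢ j → ∣w∣ i ≢ ∣w∣ j
  ∣w∣-≢ {i} {j} i≢j = i≢j ∘ absInj s i j

  value position : Fin n → Fin n
  value    = absIndex s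
  position = absIndex t

  suc-value : ∀ i → suc (toℕ (value i)) ≡ ∣w∣ i
  suc-value i = suc-index (w i) (bounded s i)

  τ∘value : ∀ i → τ (value i) ≡ signed (neg i) (suc (toℕ i))
  τ∘value i = ext-inverse τ (w i) (bounded s i) (t-inverse i)

  ∣τ∘value∣ : ∀ i → ∣ τ (value i) ∣ ≡ suc (toℕ i)
  ∣τ∘value∣ i = trans (cong ∣_∣ (τ∘value i)) (∣signed∣ (neg i) _)

  position∘value : ∀ i → position (value i) ≡ i
  position∘value i = FP.toℕ-injective (ℕP.suc-injective
    (trans (suc-index (τ (value i)) (bounded t (value i))) (∣τ∘value∣ i)))

  value∘position : ∀ v → value (position v) ≡ v
  value∘position v = absIndex-injective t (position∘value (position v))

  π : Permutation n n
  π = Perm.permutation value position value∘position position∘value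

  ∣w∣∘position : ∀ v → ∣w∣ (position v) ≡ suc (toℕ v)
  ∣w∣∘position v = trans (sym (suc-value (position v))) (cong (suc ∘ toℕ) (value∘position v))

  _≼_ : Fin n → Fin n → Bool
  j ≼ i = does (∣w∣ j ℕ.≤? ∣w∣ i)

  ≼-refl : ∀ i → i ≼ i ≡ true
  ≼-refl i = does-≤?-refl (∣w∣ i)

  count-≼ : ∀ k → k ≤ n → ∑[ j < n ] 𝟙 (does (∣w∣ j ℕ.≤? k)) ≡ k
  count-≼ k k≤n = begin
    ∑[ j < n ] 𝟙 (does (∣w∣ j ℕ.≤? k))
      ≡⟨ ℕΣ.∑-permute (λ j → 𝟙 (does (∣w∣ j ℕ.≤? k))) (Perm.flip π) ⟩
    ∑[ v < n ] 𝟙 (does (∣w∣ (position v) ℕ.≤? k))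
      ≡⟨ ℕΣ.sum-cong-≗ (λ v → cong (λ a → 𝟙 (does (a ℕ.≤? k))) (∣w∣∘position v)) ⟩
    ∑[ v < n ] 𝟙 (does (toℕ v ℕ.<? k))
      ≡⟨ ∑-indicator-< k k≤n ⟩
    k ∎

  lehCount earlier later : Fin n → ℕ
  lehCount i = ∑[ j < n ] 𝟙 (does (toℕ j ℕ.≤? toℕ i) ∧ j ≼ i)
  earlier  i = ∑[ j < n ] 𝟙 (does (toℕ j ℕ.<? toℕ i) ∧ j ≼ i)
  later    i = ∑[ j < n ] 𝟙 (does (toℕ i ℕ.<? toℕ j) ∧ j ≼ i)

  lehCount+later : ∀ i → lehCount i + later i ≡ ∣w∣ i
  lehCount+later i = begin
    lehCount i + later i
      ≡⟨ ℕΣ.∑-distrib-+ (λ j → 𝟙 (does (toℕ j ℕ.≤? toℕ i) ∧ j ≼ i))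
                        (λ j → 𝟙 (does (toℕ i ℕ.<? toℕ j) ∧ j ≼ i)) ⟨
    ∑[ j < n ] (𝟙 (does (toℕ j ℕ.≤? toℕ i) ∧ j ≼ i) + 𝟙 (does (toℕ i ℕ.<? toℕ j) ∧ j ≼ i))
      ≡⟨ ℕΣ.sum-cong-≗ (λ j → 𝟙-∧-split _ _ (j ≼ i) (≤?≡not-<? (toℕ i) (toℕ j))) ⟩
    ∑[ j < n ] 𝟙 (j ≼ i)
      ≡⟨ count-≼ (∣w∣ i) (proj₂ (bounded s i)) ⟩
    ∣w∣ i ∎

  lehCount≡suc-earlier : ∀ i → lehCount i ≡ suc (earlier i)
  lehCount≡suc-earlier i = begin
    lehCount i
      ≡⟨ ℕΣ.sum-cong-≗ split ⟩
    ∑[ j < n ] (𝟙 (does (j F.≟ i)) + 𝟙 (does (toℕ j ℕ.<? toℕ i) ∧ j ≼ i))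
      ≡⟨ ℕΣ.∑-distrib-+ (λ j → 𝟙 (does (j F.≟ i))) (λ j → 𝟙 (does (toℕ j ℕ.<? toℕ i) ∧ j ≼ i)) ⟩
    ∑[ j < n ] 𝟙 (does (j F.≟ i)) + earlier i
      ≡⟨ cong (λ k → k + earlier i) (∑-indicator-≡ i) ⟩
    suc (earlier i) ∎
    where
    split : ∀ j → 𝟙 (does (toℕ j ℕ.≤? toℕ i) ∧ j ≼ i)
                  ≡ 𝟙 (does (j F.≟ i)) + 𝟙 (does (toℕ j ℕ.<? toℕ i) ∧ j ≼ i)
    split j with j F.≟ i
    ... | yes refl rewrite does-≤?-refl (toℕ i) | does-<?-irrefl (toℕ i) | ≼-refl i = refl
    ... | no  j≢i  = cong (λ b → 𝟙 (b ∧ j ≼ i)) (≤?≡<? (j≢i ∘ FP.toℕ-injective))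

  Leh-value : ∀ i → Leh τ (value i) ≡ signed (neg i) (lehCount i)
  Leh-value i = trans (if-signed (isNeg (τ (value i))) _)
    (cong₂ signed (trans (cong isNeg (τ∘value i)) (isNeg-signed (neg i) (toℕ i))) leh-count)
    where
    before : Fin n → Bool
    before v = does ((toℕ v ℕ.≤? toℕ (value i)) ×-dec (∣ τ v ∣ ℕ.≤? ∣ τ (value i) ∣))

    leh-count : count before ≡ lehCount i
    leh-count = trans (count≡∑ before) (trans (ℕΣ.∑-permute (𝟙 ∘ before) π) (ℕΣ.sum-cong-≗ λ j → cong 𝟙
      (trans (cong₂ _∧_ (positions j) (values j)) (BP.∧-comm (j ≼ i) _))))
      where
      positions : ∀ j → does (toℕ (value j) ℕ.≤? toℕ (value i)) ≡ j ≼ i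
      positions j = trans (sym (does-≤?-suc (toℕ (value j)) (toℕ (value i))))
                          (cong₂ (λ a b → does (a ℕ.≤? b)) (suc-value j) (suc-value i))
      values : ∀ j → does (∣ τ (value j) ∣ ℕ.≤? ∣ τ (value i) ∣) ≡ does (toℕ j ℕ.≤? toℕ i)
      values j = trans (cong₂ (λ a b → does (a ℕ.≤? b)) (∣τ∘value∣ j) (∣τ∘value∣ i))
                       (does-≤?-suc (toℕ j) (toℕ i))

  codeTerm : Fin n → ℕ
  codeTerm i = if neg i then ∣w∣ i + earlier i else later i

  summand-value : ∀ i → (+ suc (toℕ (value i)) ℤ.- Leh τ (value i)) ℤ.- χneg (Leh τ (value i)) ≡ + codeTerm i
  summand-value i = trans (cong₂ (λ k a → (+ k ℤ.- a) ℤ.- χneg a) (suc-value i) (Leh-value i)) by-sign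
    where
    by-sign : (+ ∣w∣ i ℤ.- signed (neg i) (lehCount i)) ℤ.- χneg (signed (neg i) (lehCount i)) ≡ + codeTerm i
    by-sign with neg i
    ... | true  = trans (cong (λ c → (+ ∣w∣ i ℤ.- signed true c) ℤ.- χneg (signed true c)) (lehCount≡suc-earlier i))
                        (summand-neg (∣w∣ i) (earlier i))
    ... | false = trans (cong (λ m → (+ m ℤ.- + lehCount i) ℤ.- χneg (+ lehCount i)) (sym (lehCount+later i)))
                        (summand-nonneg (lehCount i) (later i))

  invEntry codeEntry : Fin n → Fin n → ℕ
  invEntry i j = 𝟙 (does ((toℕ i ℕ.<? toℕ j) ×-dec (w j ℤ.<? w i)))
               + 𝟙 (does ((toℕ i ℕ.≤? toℕ j) ×-dec (w j ℤ.<? - w i)))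
  codeEntry i j = if neg i then 𝟙 (j ≼ i) + 𝟙 (does (toℕ j ℕ.<? toℕ i) ∧ j ≼ i)
                           else 𝟙 (does (toℕ i ℕ.<? toℕ j) ∧ j ≼ i)

  invB≡∑∑invEntry : invB s ≡ ∑[ i < n ] ∑[ j < n ] invEntry i j
  invB≡∑∑invEntry = begin
    invB s
      ≡⟨ cong₂ _+_ (count₂≡∑∑ strict) (count₂≡∑∑ weak) ⟩
    ∑[ i < n ] ∑[ j < n ] 𝟙 (strict i j) + ∑[ i < n ] ∑[ j < n ] 𝟙 (weak i j)
      ≡⟨ ℕΣ.∑-distrib-+ (λ i → ∑[ j < n ] 𝟙 (strict i j)) (λ i → ∑[ j < n ] 𝟙 (weak i j)) ⟨
    ∑[ i < n ] (∑[ j < n ] 𝟙 (strict i j) + ∑[ j < n ] 𝟙 (weak i j))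
      ≡⟨ ℕΣ.sum-cong-≗ (λ i → sym (ℕΣ.∑-distrib-+ (𝟙 ∘ strict i) (𝟙 ∘ weak i))) ⟩
    ∑[ i < n ] ∑[ j < n ] invEntry i j ∎
    where
    strict weak : Fin n → Fin n → Bool
    strict i j = does ((toℕ i ℕ.<? toℕ j) ×-dec (w j ℤ.<? w i))
    weak   i j = does ((toℕ i ℕ.≤? toℕ j) ×-dec (w j ℤ.<? - w i))

  codeEntry-row : ∀ i → ∑[ j < n ] codeEntry i j ≡ codeTerm i
  codeEntry-row i = trans (∑-if (neg i) negRow (λ j → 𝟙 (does (toℕ i ℕ.<? toℕ j) ∧ j ≼ i)))
                          (cong (λ k → if neg i then k else later i) negRow-sum)
    where
    negRow : Fin n → ℕ
    negRow j = 𝟙 (j ≼ i) + 𝟙 (does (toℕ j ℕ.<? toℕ i) ∧ j ≼ i)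
    negRow-sum : ∑[ j < n ] negRow j ≡ ∣w∣ i + earlier i
    negRow-sum = begin
      ∑[ j < n ] negRow j
        ≡⟨ ℕΣ.∑-distrib-+ (λ j → 𝟙 (j ≼ i)) (λ j → 𝟙 (does (toℕ j ℕ.<? toℕ i) ∧ j ≼ i)) ⟩
      ∑[ j < n ] 𝟙 (j ≼ i) + earlier i
        ≡⟨ cong (λ k → k + earlier i) (count-≼ (∣w∣ i) (proj₂ (bounded s i))) ⟩
      ∣w∣ i + earlier i ∎

  invEntry-diagonal : ∀ i → invEntry i i ≡ codeEntry i i
  invEntry-diagonal i
    rewrite does-<?-irrefl (toℕ i) | does-≤?-refl (toℕ i) | ≼-refl i | <?-negate-self (w i) (nonzero i)
    with neg i
  ... | true  = refl
  ... | false = refl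

  invEntry-pair : ∀ i j → invEntry i j + invEntry j i ≡ codeEntry i j + codeEntry j i
  invEntry-pair i j with i F.≟ j
  ... | yes refl = cong₂ _+_ (invEntry-diagonal i) (invEntry-diagonal i)
  ... | no  i≢j  = pair-table {sx = neg i} {sy = neg j}
    refl (≤?≡<? i≢ʲ) (<?-flip i≢ʲ) (≤?≡not-<? (toℕ i) (toℕ j))
    (≤?≡<? ∣j∣≢∣i∣) (≤?≡not-<? (∣w∣ j) (∣w∣ i))
    (<?-by-sign (w i) (w j) (nonzero i) (nonzero j) ∣i∣≢∣j∣)
    (<?-negate-by-sign (w i) (w j) (nonzero i) (nonzero j) ∣i∣≢∣j∣)
    (trans (<?-by-sign (w j) (w i) (nonzero j) (nonzero i) ∣j∣≢∣i∣)
           (cong (ltSigned (neg j) (neg i)) (<?-flip ∣j∣≢∣i∣)))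
    (trans (<?-negate-by-sign (w j) (w i) (nonzero j) (nonzero i) ∣j∣≢∣i∣)
           (cong (ltSigned (not (neg j)) (neg i)) (<?-flip ∣j∣≢∣i∣)))
    where
    i≢ʲ : toℕ i ≢ toℕ j
    i≢ʲ = i≢j ∘ FP.toℕ-injective
    ∣i∣≢∣j∣ : ∣w∣ i ≢ ∣w∣ j
    ∣i∣≢∣j∣ = ∣w∣-≢ i≢j
    ∣j∣≢∣i∣ : ∣w∣ j ≢ ∣w∣ i
    ∣j∣≢∣i∣ = ∣i∣≢∣j∣ ∘ sym

  invB≡∑codeTerm : invB s ≡ ∑[ i < n ] codeTerm i
  invB≡∑codeTerm = begin
    invB s                                   ≡⟨ invB≡∑∑invEntry ⟩
    ∑[ i < n ] ∑[ j < n ] invEntry i j       ≡⟨ ∑∑-symmetrize invEntry codeEntry invEntry-pair ⟩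
    ∑[ i < n ] ∑[ j < n ] codeEntry i j      ≡⟨ ℕΣ.sum-cong-≗ codeEntry-row ⟩
    ∑[ i < n ] codeTerm i                    ∎

  invB-formula : + invB s ≡ sumℤ (λ v → ((+ suc (toℕ v)) ℤ.- Leh τ v) ℤ.- χneg (Leh τ v))
  invB-formula = begin
    + invB s                                 ≡⟨ cong +_ invB≡∑codeTerm ⟩
    + (∑[ i < n ] codeTerm i)                ≡⟨ +-∑ codeTerm ⟩
    ℤΣ.sum (+_ ∘ codeTerm)                   ≡⟨ ℤΣ.sum-cong-≗ summand-value ⟨
    ℤΣ.sum (summand ∘ value)                 ≡⟨ ℤΣ.∑-permute summand π ⟨
    ℤΣ.sum summand                           ≡⟨ sumℤ≡∑ summand ⟨
    sumℤ summand                             ∎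
    where
    summand : Fin n → ℤ
    summand v = ((+ suc (toℕ v)) ℤ.- Leh τ v) ℤ.- χneg (Leh τ v)

  hasSmallerLater : Fin n → Bool
  hasSmallerLater i = any (λ j → does ((toℕ i ℕ.<? toℕ j) ×-dec (+ ∣ w j ∣ ℤ.<? w i))) (allFin n)

  hasSmallerLater-neg : ∀ i → neg i ≡ true → hasSmallerLater i ≡ false
  hasSmallerLater-neg i neg≡ = trans (any-tabulate n id _) (cong (λ k → does (0 ℕ.<? k)) (∑-zero _ λ j →
    trans (cong (λ b → 𝟙 (does (toℕ i ℕ.<? toℕ j) ∧ b)) (+<?-neg (∣w∣ j) (w i) neg≡))
          (cong 𝟙 (BP.∧-zeroʳ _))))

  hasSmallerLater-nonneg : ∀ i → neg i ≡ false → hasSmallerLater i ≡ does (0 ℕ.<? later i)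
  hasSmallerLater-nonneg i neg≡ = trans (any-tabulate n id _) (cong (λ k → does (0 ℕ.<? k)) (ℕΣ.sum-cong-≗ λ j →
    cong 𝟙 (trans (cong (does (toℕ i ℕ.<? toℕ j) ∧_) (+<?-nonneg (∣w∣ j) (w i) neg≡))
                  (strict⇔weak j (toℕ i ℕ.<? toℕ j)))))
    where
    strict⇔weak : ∀ j (i<?j : Dec (toℕ i < toℕ j)) → does i<?j ∧ does (∣w∣ j ℕ.<? ∣w∣ i) ≡ does i<?j ∧ j ≼ i
    strict⇔weak j (no  _)   = refl
    strict⇔weak j (yes i<j) = sym (≤?≡<? (∣w∣-≢ (λ j≡i → ℕP.<⇒≢ i<j (cong toℕ (sym j≡i)))))

  isMax : Fin n → Bool
  isMax v = does (Leh τ v ℤ.≟ + suc (toℕ v))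

  exactly-one : ∀ i → 𝟙 (hasSmallerLater i) + 𝟙 (neg i) + 𝟙 (isMax (value i)) ≡ 1
  exactly-one i = trans (cong (λ b → 𝟙 (hasSmallerLater i) + 𝟙 (neg i) + 𝟙 b)
                              (cong₂ (λ a k → does (a ℤ.≟ + k)) (Leh-value i) (suc-value i)))
                        by-sign
    where
    by-sign : 𝟙 (hasSmallerLater i) + 𝟙 (neg i) + 𝟙 (does (signed (neg i) (lehCount i) ℤ.≟ + ∣w∣ i)) ≡ 1
    by-sign with neg i in neg≡
    ... | true  rewrite hasSmallerLater-neg i neg≡ | lehCount≡suc-earlier i = refl
    ... | false rewrite hasSmallerLater-nonneg i neg≡ =
      trans (cong (λ k → k + 𝟙 (does (+ lehCount i ℤ.≟ + ∣w∣ i))) (ℕP.+-identityʳ _))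
            (positive-or-equal (lehCount i) (later i) (∣w∣ i) (lehCount+later i))

  nminB+maxCount≡n : nminB s + maxCount (Leh τ) ≡ n
  nminB+maxCount≡n = begin
    nminB s + maxCount (Leh τ)
      ≡⟨ cong₂ _+_ (cong₂ _+_ (count≡∑ hasSmallerLater) (count≡∑ neg))
                   (trans (count≡∑ isMax) (ℕΣ.∑-permute (𝟙 ∘ isMax) π)) ⟩
    ∑[ i < n ] 𝟙 (hasSmallerLater i) + ∑[ i < n ] 𝟙 (neg i) + ∑[ i < n ] 𝟙 (isMax (value i))
      ≡⟨ cong (_+ ∑[ i < n ] 𝟙 (isMax (value i))) (ℕΣ.∑-distrib-+ (𝟙 ∘ hasSmallerLater) (𝟙 ∘ neg)) ⟨
    ∑[ i < n ] (𝟙 (hasSmallerLater i) + 𝟙 (neg i)) + ∑[ i < n ] 𝟙 (isMax (value i))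
      ≡⟨ ℕΣ.∑-distrib-+ (λ i → 𝟙 (hasSmallerLater i) + 𝟙 (neg i)) (𝟙 ∘ isMax ∘ value) ⟨
    ∑[ i < n ] (𝟙 (hasSmallerLater i) + 𝟙 (neg i) + 𝟙 (isMax (value i)))
      ≡⟨ ∑-one _ exactly-one ⟩
    n ∎

  nminB-formula : nminB s ≡ n ∸ maxCount (Leh τ)
  nminB-formula = trans (sym (ℕP.m+n∸n≡m (nminB s) (maxCount (Leh τ))))
                        (cong (_∸ maxCount (Leh τ)) nminB+maxCount≡n)

lemma3p5 : (n : ℕ) → 1 ≤ n → (s t : SignedPerm n) → IsInverse s t →
    let a = Leh (σ t) in
    (+ invB s ≡ sumℤ (λ i → ((+ suc (toℕ i)) ℤ.- a i) ℤ.- χneg (a i)))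
    × (nminB s ≡ n ∸ maxCount a)
-- Both formulas also hold for n = 0.
lemma3p5 n _ s t t-inverse = invB-formula , nminB-formula
  where open InversePair s t t-inverse
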